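{- For every formula $\varphi$ of propositional linear temporal logic, $\mathrm{LTL} \models \neg \Box (\varphi\leftrightarrow\bigcirc\Box\neg\varphi)$.
   Context: Propositional linear temporal logic (LTL) over a set $\mathbf{V}$ of propositional constants, with formulas built from $\mathbf{V}$, $\mathbf{false}$, $\rightarrow$, the "next" operator $\bigcirc$ and the "always" operator $\Box$; $\diamondsuit\varphi$ abbreviates $\neg\Box\neg\varphi$. A temporal (Kripke) structure is an infinite sequence $\mathcal{K}=(\eta_0,\eta_1,\dots)$ of valuations $\eta_i:\mathbf{V}\to\{\mathfrak{ff},\mathfrak{tt}\}$, with $\mathcal{K}_i(v)=\eta_i(v)$, classical clauses for the connectives, $\mathcal{K}_i(\bigcirc\varphi)=\mathcal{K}_{i+1}(\varphi)$, and $\mathcal{K}_i(\Box\varphi)=\mathfrak{tt}$ iff $\mathcal{K}_j(\varphi)=\mathfrak{tt}$ for all $j\ge i$. $\mathrm{LTL}\models\varphi$ (validity) means $\mathcal{K}_i(\varphi)=\mathfrak{tt}$ for every temporal structure $\mathcal{K}$ and every $i\in\mathbb{N}$; equivalently, $\neg\varphi$ is not satisfiable. -}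

module Defs where

open import Data.Nat using (ℕ; suc; _≤_)
open import Data.Bool using (Bool; true)
open import Data.Empty using (⊥)
open import Relation.Binary.PropositionalEquality using (_≡_)

data Formula (V : Set) : Set where
  var   : V → Formula V
  false : Formula V
  _⇒_   : Formula V → Formula V → Formula V
  ○_    : Formula V → Formula V
  □_    : Formula V → Formula V

infixr 5 _⇒_
infix 7 ○_ □_ ◇_

¬ᶠ_ : {V : Set} → Formula V → Formula V
¬ᶠ φ = φ ⇒ false

infix 7 ¬ᶠ_

_∧ᶠ_ : {V : Set} → Formula V → Formula V → Formula V
φ ∧ᶠ ψ = ¬ᶠ (φ ⇒ ¬ᶠ ψ)

_⇔_ : {V : Set} → Formula V → Formula V → Formula V
φ ⇔ ψ = (φ ⇒ ψ) ∧ᶠ (ψ ⇒ φ)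

infix 4 _⇔_

◇_ : {V : Set} → Formula V → Formula V
◇ φ = ¬ᶠ □ ¬ᶠ φ

TemporalStructure : Set → Set
TemporalStructure V = ℕ → V → Bool

-- K_i(φ) = tt, rendered as a proposition
Sat : {V : Set} → TemporalStructure V → ℕ → Formula V → Set
Sat K i (var v) = K i v ≡ true
Sat K i false   = ⊥
Sat K i (φ ⇒ ψ) = Sat K i φ → Sat K i ψ
Sat K i (○ φ)   = Sat K (suc i) φ
Sat K i (□ φ)   = (j : ℕ) → i ≤ j → Sat K j φ

Valid : {V : Set} → Formula V → Set
Valid {V} φ = (K : TemporalStructure V) (i : ℕ) → Sat K i φ

-- The argument is a Yablo-style paradox about an arbitrary predicate P on ℕ.
-- Suppose that for every j ≥ i, P j holds iff P k fails for all k > j.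
-- First, P fails everywhere from i on: if P j held, then P would fail at all
-- k > j, in particular everywhere after j + 1, so P (j + 1) would hold by the
-- fixpoint equation at j + 1 — contradicting the failure at j + 1.  Second,
-- P then fails at all k > i, so P i holds by the equation at i — contradicting
-- the first step.  Since the semantics is constructive, the equations are only
-- available under a double negation; this suffices because the goal is ⊥.
module Submission where

open import Defs
open import Data.Nat using (ℕ; suc; _≤_; _<_)
open import Data.Nat.Properties using (≤-refl; ≤-trans; n≤1+n; <-trans; <⇒≤)
open import Data.Product using (_×_; _,_)
open import Data.Empty using (⊥)
open import Relation.Nullary using (¬_)

NeverAfter : (ℕ → Set) → ℕ → Set
NeverAfter P j = ∀ k → j < k → ¬ P k

no-yablo-predicate : (P : ℕ → Set) (i : ℕ) →
  (∀ j → i ≤ j → ¬ ¬ ((P j → NeverAfter P j) × (NeverAfter P j → P j))) → ⊥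
no-yablo-predicate P i fix = fix i ≤-refl λ where
    (_ , never⇒P) → never-from-i i ≤-refl (never⇒P λ k i<k → never-from-i k (<⇒≤ i<k))
  where
  -- P fails everywhere from i on: P j would force P (j + 1) and its negation.
  never-from-i : ∀ j → i ≤ j → ¬ P j
  never-from-i j i≤j Pj =
    fix j i≤j λ { (P⇒never , _) →
    fix (suc j) (≤-trans i≤j (n≤1+n j)) λ { (_ , never⇒P) →
    let neverAfter-j = P⇒never Pj
    in neverAfter-j (suc j) ≤-refl
         (never⇒P λ k j+1<k → neverAfter-j k (<-trans ≤-refl j+1<k)) } }

Sat-⇔ : {V : Set} (K : TemporalStructure V) (j : ℕ) (φ ψ : Formula V) →
  Sat K j (φ ⇔ ψ) → ¬ ¬ ((Sat K j φ → Sat K j ψ) × (Sat K j ψ → Sat K j φ))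
Sat-⇔ K j φ ψ h k = h λ φ⇒ψ ψ⇒φ → k (φ⇒ψ , ψ⇒φ)

theorem3p3 : {V : Set} (φ : Formula V) → Valid (¬ᶠ □ (φ ⇔ ○ □ ¬ᶠ φ))
theorem3p3 φ K i always-fix =
  no-yablo-predicate (λ j → Sat K j φ) i λ j i≤j → Sat-⇔ K j φ (○ □ ¬ᶠ φ) (always-fix j i≤j)
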